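{- For every $n\in\mathbb{N}$, every $\lambda\in\mathbb{N}$ and every sequence $z=(z_1,z_2,\dots)$, \[ Q_{n,0}(\lambda,z) = z_n+\sum_{i=1}^{\lambda} \frac{i}{\lambda+1}\sum_{m=1}^{n-1}\binom{n}{m}z_{n-m}\,Q_{m,0}(i-1,z). \]
   Context: The partial Bell polynomial is $B_{n,k}(z)=\sum\frac{n!}{i_1!i_2!\cdots}\left(\frac{z_1}{1!}\right)^{i_1}\left(\frac{z_2}{2!}\right)^{i_2}\cdots$, summed over all sequences $(i_1,i_2,\dots)$ of nonnegative integers with $i_1+i_2+\dots=k$ and $i_1+2i_2+\dots=n$. For $n\in\mathbb{N}$, $b\in\mathbb{Z}$, $\lambda\in\mathbb{C}$, $Q_{n,b}(\lambda,z)=\sum_{k=1}^{n}\binom{\lambda+bk}{k-1}(k-1)!\,B_{n,k}(z)$, with generalized binomial coefficients. -}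

module Defs where

open import Level using (Level)
open import Data.Nat as ℕ using (ℕ; zero; suc; _∸_; _≡ᵇ_; _!)
open import Data.Nat.DivMod using (_/_)
open import Data.Nat.Combinatorics using (_C_)
open import Data.List using (List; []; _∷_; [_]; map; concatMap; upTo; filterᵇ; foldr)
open import Data.Bool using (_∧_)
open import Algebra.Bundles using (CommutativeRing)

-- Truncated natural division (denominators used below are never 0).
_div_ : ℕ → ℕ → ℕ
a div zero = 0
a div suc b = a / suc b

tuples : ℕ → ℕ → List (List ℕ)
tuples zero b = [ [] ]
tuples (suc len) b = concatMap (λ x → map (x ∷_) (tuples len b)) (upTo (suc b))

sumL : List ℕ → ℕ
sumL = foldr ℕ._+_ 0

wsumFrom : ℕ → List ℕ → ℕ
wsumFrom j [] = 0
wsumFrom j (i ∷ is) = j ℕ.* i ℕ.+ wsumFrom (suc j) is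

denomFrom : ℕ → List ℕ → ℕ
denomFrom j [] = 1
denomFrom j (i ∷ is) = (i !) ℕ.* ((j !) ℕ.^ i) ℕ.* denomFrom (suc j) is

-- The index sequences (i_1,…,i_n) with Σ i_j = k and Σ j i_j = n.
-- (Any i_j with j > n must be 0, and i_j ≤ n, so this enumeration is complete.)
bellIndices : ℕ → ℕ → List (List ℕ)
bellIndices n k = filterᵇ (λ is → (sumL is ≡ᵇ k) ∧ (wsumFrom 1 is ≡ᵇ n)) (tuples n n)

module _ {c ℓ : Level} (R : CommutativeRing c ℓ) where
  open CommutativeRing R

  ofℕ : ℕ → Carrier
  ofℕ zero = 0#
  ofℕ (suc n) = 1# + ofℕ n

  pow : Carrier → ℕ → Carrier
  pow x zero = 1#
  pow x (suc n) = x * pow x n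

  sumTo : (ℕ → Carrier) → ℕ → Carrier
  sumTo f zero = 0#
  sumTo f (suc n) = sumTo f n + f (suc n)

  sumList : List Carrier → Carrier
  sumList = foldr _+_ 0#

  monoFrom : (ℕ → Carrier) → ℕ → List ℕ → Carrier
  monoFrom z j [] = 1#
  monoFrom z j (i ∷ is) = pow (z j) i * monoFrom z (suc j) is

  bell : ℕ → ℕ → (ℕ → Carrier) → Carrier
  bell n k z = sumList (map (λ is → ofℕ ((n !) div denomFrom 1 is) * monoFrom z 1 is)
                            (bellIndices n k))

  Q0 : ℕ → ℕ → (ℕ → Carrier) → Carrier
  Q0 n lam z = sumTo (λ k → ofℕ ((lam C (k ∸ 1)) ℕ.* ((k ∸ 1) !)) * bell n k z) n

-- Let ⊛ be the binomial convolution of sequences (the product of exponential generating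
-- functions) and z₊ the sequence z with z₀ replaced by 0. Then k! B_{n,k}(z) is the n-th term
-- of z₊ ^⊛ k: peeling off the parts of the smallest size j, this is the binomial theorem for
-- (z_j at index j + the sequence restricted to sizes > j) ^⊛ k. Since
-- (λ+1) C(λ, k-1) (k-1)! = C(λ+1, k) k!, for n ≥ 1 the value (λ+1) Q_{n,0}(λ, z) is the n-th term
-- of E_{λ+1} = (δ + z₊) ^⊛ (λ+1). The recurrence E_{i+1} = E_i + E_i ⊛ z₊ telescopes, and the
-- n-th term of E_i ⊛ z₊ is z_n + i Σ_m C(n,m) z_{n-m} Q_{m,0}(i-1, z) by the same identity;
-- multiplying by w = 1/(λ+1) gives the formula.
module Submission where

open import Defs
open import Level using (Level)
open import Data.Nat using (ℕ; suc; _∸_; _≤_; s≤s; z≤n)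
open import Data.Nat.Combinatorics using (_C_)
open import Algebra.Bundles using (CommutativeRing)

module Combinatorics where

  open import Data.Bool using (true; false; T)
  open import Data.Unit using (tt)
  open import Data.List using (List; []; _∷_)
  open import Data.Nat
  open import Data.Nat.Properties
  open import Data.Nat.DivMod using (_/_; m*n/n≡m; m/n*n≡m)
  open import Data.Nat.Combinatorics
  open import Data.Nat.Combinatorics.Specification using (nCk≡n!/k![n-k]!; k>n⇒nCk≡0)
  open import Relation.Binary.PropositionalEquality
  open import Relation.Nullary using (yes; no)
  open import Data.Nat.Solver using (module +-*-Solver)
  open +-*-Solver
  open ≡-Reasoning

  nCk*[k!*[n∸k]!]≡n! : ∀ {n k} → k ≤ n → (n C k) * (k ! * (n ∸ k) !) ≡ n !
  nCk*[k!*[n∸k]!]≡n! {n} {k} k≤n = begin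
    (n C k) * (k ! * (n ∸ k) !)
      ≡⟨ cong (_* (k ! * (n ∸ k) !)) (nCk≡n!/k![n-k]! k≤n) ⟩
    (n ! / (k ! * (n ∸ k) !)) {{k !* (n ∸ k) !≢0}} * (k ! * (n ∸ k) !)
      ≡⟨ m/n*n≡m {{k !* (n ∸ k) !≢0}} (k![n∸k]!∣n! k≤n) ⟩
    n ! ∎

  [m+n]Cm*[m!*n!]≡[m+n]! : ∀ m n → ((m + n) C m) * (m ! * n !) ≡ (m + n) !
  [m+n]Cm*[m!*n!]≡[m+n]! m n =
    subst (λ t → ((m + n) C m) * (m ! * t !) ≡ (m + n) !) (m+n∸m≡n m n) (nCk*[k!*[n∸k]!]≡n! (m≤m+n m n))

  [a+b+r]Ca*[b+r]Cb≡[a+b+r]C[a+b]*[a+b]Ca : ∀ a b r →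
    ((a + b + r) C a) * ((b + r) C b) ≡ ((a + b + r) C (a + b)) * ((a + b) C a)
  [a+b+r]Ca*[b+r]Cb≡[a+b+r]C[a+b]*[a+b]Ca a b r =
    *-cancelʳ-≡ _ _ (a ! * b ! * r !) {{m*n≢0 _ _ {{a !* b !≢0}} {{r !≢0}}}} (trans lhs (sym rhs))
    where
    lhs : ((a + b + r) C a) * ((b + r) C b) * (a ! * b ! * r !) ≡ (a + b + r) !
    lhs = begin
      ((a + b + r) C a) * ((b + r) C b) * (a ! * b ! * r !)
        ≡⟨ solve 5 (λ x y z u v → x :* y :* (z :* u :* v) := x :* (z :* (y :* (u :* v)))) refl ((a + b + r) C a) ((b + r) C b) (a !) (b !) (r !) ⟩
      ((a + b + r) C a) * (a ! * (((b + r) C b) * (b ! * r !)))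
        ≡⟨ cong (λ t → ((a + b + r) C a) * (a ! * t)) ([m+n]Cm*[m!*n!]≡[m+n]! b r) ⟩
      ((a + b + r) C a) * (a ! * (b + r) !)
        ≡⟨ cong (λ t → (t C a) * (a ! * (b + r) !)) (+-assoc a b r) ⟩
      ((a + (b + r)) C a) * (a ! * (b + r) !)
        ≡⟨ [m+n]Cm*[m!*n!]≡[m+n]! a (b + r) ⟩
      (a + (b + r)) !
        ≡⟨ cong _! (+-assoc a b r) ⟨
      (a + b + r) ! ∎
    rhs : ((a + b + r) C (a + b)) * ((a + b) C a) * (a ! * b ! * r !) ≡ (a + b + r) !
    rhs = begin
      ((a + b + r) C (a + b)) * ((a + b) C a) * (a ! * b ! * r !)
        ≡⟨ solve 5 (λ x y z u v → x :* y :* (z :* u :* v) := x :* (y :* (z :* u) :* v)) refl ((a + b + r) C (a + b)) ((a + b) C a) (a !) (b !) (r !) ⟩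
      ((a + b + r) C (a + b)) * (((a + b) C a) * (a ! * b !) * r !)
        ≡⟨ cong (λ t → ((a + b + r) C (a + b)) * (t * r !)) ([m+n]Cm*[m!*n!]≡[m+n]! a b) ⟩
      ((a + b + r) C (a + b)) * ((a + b) ! * r !)
        ≡⟨ [m+n]Cm*[m!*n!]≡[m+n]! (a + b) r ⟩
      (a + b + r) ! ∎

  nCa*[n∸a]Cb≡nC[a+b]*[a+b]Ca : ∀ n a b → a + b ≤ n → (n C a) * ((n ∸ a) C b) ≡ (n C (a + b)) * ((a + b) C a)
  nCa*[n∸a]Cb≡nC[a+b]*[a+b]Ca n a b a+b≤n = begin
    (n C a) * ((n ∸ a) C b)                   ≡⟨ cong (λ m → (m C a) * ((m ∸ a) C b)) n≡a+b+r ⟩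
    ((a + b + r) C a) * ((a + b + r ∸ a) C b) ≡⟨ cong (λ t → ((a + b + r) C a) * (t C b)) a+b+r∸a≡b+r ⟩
    ((a + b + r) C a) * ((b + r) C b)         ≡⟨ [a+b+r]Ca*[b+r]Cb≡[a+b+r]C[a+b]*[a+b]Ca a b r ⟩
    ((a + b + r) C (a + b)) * ((a + b) C a)   ≡⟨ cong (λ m → (m C (a + b)) * ((a + b) C a)) n≡a+b+r ⟨
    (n C (a + b)) * ((a + b) C a) ∎
    where
    r = n ∸ (a + b)
    n≡a+b+r : n ≡ a + b + r
    n≡a+b+r = sym (m+[n∸m]≡n a+b≤n)
    a+b+r∸a≡b+r : a + b + r ∸ a ≡ b + r
    a+b+r∸a≡b+r = trans (cong (_∸ a) (+-assoc a b r)) (m+n∸m≡n a (b + r))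

  [1+k]*[1+n]C[1+k]≡[1+n]*nCk : ∀ n k → suc k * (suc n C suc k) ≡ suc n * (n C k)
  [1+k]*[1+n]C[1+k]≡[1+n]*nCk n k with k ≤? n
  ... | no k≰n = begin
    suc k * (suc n C suc k) ≡⟨ cong (suc k *_) (k>n⇒nCk≡0 (s≤s (≰⇒> k≰n))) ⟩
    suc k * 0               ≡⟨ *-zeroʳ (suc k) ⟩
    0                       ≡⟨ *-zeroʳ (suc n) ⟨
    suc n * 0               ≡⟨ cong (suc n *_) (k>n⇒nCk≡0 (≰⇒> k≰n)) ⟨
    suc n * (n C k) ∎
  ... | yes k≤n = *-cancelʳ-≡ _ _ (k ! * (n ∸ k) !) {{k !* (n ∸ k) !≢0}} (begin
    suc k * (suc n C suc k) * (k ! * (n ∸ k) !)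
      ≡⟨ solve 4 (λ a b c d → (con 1 :+ a) :* b :* (c :* d) := b :* ((c :+ a :* c) :* d)) refl k (suc n C suc k) (k !) ((n ∸ k) !) ⟩
    (suc n C suc k) * (suc k ! * (suc n ∸ suc k) !) ≡⟨ nCk*[k!*[n∸k]!]≡n! (s≤s k≤n) ⟩
    suc n !                                         ≡⟨ cong (suc n *_) (nCk*[k!*[n∸k]!]≡n! k≤n) ⟨
    suc n * ((n C k) * (k ! * (n ∸ k) !))           ≡⟨ *-assoc (suc n) (n C k) _ ⟨
    suc n * (n C k) * (k ! * (n ∸ k) !) ∎)

  [1+L]*[LCk*k!]≡[1+L]C[1+k]*[1+k]! : ∀ L k → suc L * ((L C k) * k !) ≡ (suc L C suc k) * suc k !
  [1+L]*[LCk*k!]≡[1+L]C[1+k]*[1+k]! L k = begin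
    suc L * ((L C k) * k !)       ≡⟨ *-assoc (suc L) (L C k) (k !) ⟨
    suc L * (L C k) * k !         ≡⟨ cong (_* k !) ([1+k]*[1+n]C[1+k]≡[1+n]*nCk L k) ⟨
    suc k * (suc L C suc k) * k ! ≡⟨ solve 3 (λ a b f → (con 1 :+ a) :* b :* f := b :* ((con 1 :+ a) :* f)) refl k (suc L C suc k) (k !) ⟩
    (suc L C suc k) * suc k ! ∎

  -- (jx)! / (j!)^x and (jx)! / (x! (j!)^x): the ways to split jx labelled points into x blocks
  -- of size j, the blocks being ordered resp. unordered.
  orderedBlocks : ℕ → ℕ → ℕ
  orderedBlocks j zero = 1
  orderedBlocks j (suc x) = ((j * suc x) C j) * orderedBlocks j x

  unorderedBlocks : ℕ → ℕ → ℕ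
  unorderedBlocks j zero = 1
  unorderedBlocks j (suc x) = ((j * suc x ∸ 1) C (j ∸ 1)) * unorderedBlocks j x

  orderedBlocks*j!^x≡[j*x]! : ∀ j x → orderedBlocks j x * (j !) ^ x ≡ (j * x) !
  orderedBlocks*j!^x≡[j*x]! j zero = cong _! (sym (*-zeroʳ j))
  orderedBlocks*j!^x≡[j*x]! j (suc x) = begin
    ((j * suc x) C j) * orderedBlocks j x * (j ! * (j !) ^ x)
      ≡⟨ solve 4 (λ a b c d → a :* b :* (c :* d) := a :* (c :* (b :* d))) refl ((j * suc x) C j) (orderedBlocks j x) (j !) ((j !) ^ x) ⟩
    ((j * suc x) C j) * (j ! * (orderedBlocks j x * (j !) ^ x))
      ≡⟨ cong (λ t → ((j * suc x) C j) * (j ! * t)) (orderedBlocks*j!^x≡[j*x]! j x) ⟩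
    ((j * suc x) C j) * (j ! * (j * x) !)
      ≡⟨ cong (λ t → (t C j) * (j ! * (j * x) !)) (*-suc j x) ⟩
    ((j + j * x) C j) * (j ! * (j * x) !)
      ≡⟨ [m+n]Cm*[m!*n!]≡[m+n]! j (j * x) ⟩
    (j + j * x) !
      ≡⟨ cong _! (*-suc j x) ⟨
    (j * suc x) ! ∎

  -- Choosing the block of the last point: (1+x) * C(j(1+x) - 1, j - 1) = C(j(1+x), j).
  x!*unorderedBlocks≡orderedBlocks : ∀ j x → .{{NonZero j}} → x ! * unorderedBlocks j x ≡ orderedBlocks j x
  x!*unorderedBlocks≡orderedBlocks j zero = refl
  x!*unorderedBlocks≡orderedBlocks j@(suc j′) (suc x) = begin
    suc x ! * (c * unorderedBlocks j x)
      ≡⟨ solve 4 (λ a f b u → (f :+ a :* f) :* (b :* u) := (con 1 :+ a) :* b :* (f :* u)) refl x (x !) c (unorderedBlocks j x) ⟩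
    suc x * c * (x ! * unorderedBlocks j x)
      ≡⟨ cong₂ _*_ [1+x]*c≡[j*[1+x]]Cj (x!*unorderedBlocks≡orderedBlocks j x) ⟩
    ((j * suc x) C j) * orderedBlocks j x ∎
    where
    M = x + j′ * suc x
    c = M C j′
    [1+x]*c≡[j*[1+x]]Cj : suc x * c ≡ (j * suc x) C j
    [1+x]*c≡[j*[1+x]]Cj = *-cancelˡ-≡ _ _ j (begin
      j * (suc x * c)         ≡⟨ solve 3 (λ a b d → (con 1 :+ a) :* ((con 1 :+ b) :* d) := (con 1 :+ b :+ a :* (con 1 :+ b)) :* d) refl j′ x c ⟩
      suc M * c               ≡⟨ [1+k]*[1+n]C[1+k]≡[1+n]*nCk M j′ ⟨
      j * ((j * suc x) C j) ∎)

  k!*unorderedBlocks≡kCx*orderedBlocks*[k∸x]! : ∀ j k x → .{{NonZero j}} → x ≤ k →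
    k ! * unorderedBlocks j x ≡ (k C x) * orderedBlocks j x * (k ∸ x) !
  k!*unorderedBlocks≡kCx*orderedBlocks*[k∸x]! j k x x≤k = begin
    k ! * unorderedBlocks j x
      ≡⟨ cong (_* unorderedBlocks j x) (nCk*[k!*[n∸k]!]≡n! x≤k) ⟨
    (k C x) * (x ! * (k ∸ x) !) * unorderedBlocks j x
      ≡⟨ solve 4 (λ a f r u → a :* (f :* r) :* u := a :* (f :* u) :* r) refl (k C x) (x !) ((k ∸ x) !) (unorderedBlocks j x) ⟩
    (k C x) * (x ! * unorderedBlocks j x) * (k ∸ x) !
      ≡⟨ cong (λ t → (k C x) * t * (k ∸ x) !) (x!*unorderedBlocks≡orderedBlocks j x) ⟩
    (k C x) * orderedBlocks j x * (k ∸ x) ! ∎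

  choose-orderedBlocks-suc : ∀ n j x → j ≤ n → j * suc x ≤ n →
    (n C (n ∸ j)) * (((n ∸ j) C (j * x)) * orderedBlocks j x) ≡ (n C (j * suc x)) * orderedBlocks j (suc x)
  choose-orderedBlocks-suc n j x j≤n j[1+x]≤n = begin
    (n C (n ∸ j)) * (((n ∸ j) C (j * x)) * orderedBlocks j x)
      ≡⟨ *-assoc (n C (n ∸ j)) _ _ ⟨
    (n C (n ∸ j)) * ((n ∸ j) C (j * x)) * orderedBlocks j x
      ≡⟨ cong (λ t → t * ((n ∸ j) C (j * x)) * orderedBlocks j x) (nCk≡nC[n∸k] j≤n) ⟨
    (n C j) * ((n ∸ j) C (j * x)) * orderedBlocks j x
      ≡⟨ cong (_* orderedBlocks j x) (nCa*[n∸a]Cb≡nC[a+b]*[a+b]Ca n j (j * x) (subst (_≤ n) (*-suc j x) j[1+x]≤n)) ⟩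
    (n C (j + j * x)) * ((j + j * x) C j) * orderedBlocks j x
      ≡⟨ cong (λ t → (n C t) * (t C j) * orderedBlocks j x) (*-suc j x) ⟨
    (n C (j * suc x)) * ((j * suc x) C j) * orderedBlocks j x
      ≡⟨ *-assoc (n C (j * suc x)) _ _ ⟩
    (n C (j * suc x)) * orderedBlocks j (suc x) ∎

  nC[a+m]*[[a+m]Ca*g]≡nCa*g*[n∸a]Cm : ∀ n a g m → a + m ≤ n →
    (n C (a + m)) * (((a + m) C a) * g) ≡ (n C a) * g * ((n ∸ a) C m)
  nC[a+m]*[[a+m]Ca*g]≡nCa*g*[n∸a]Cm n a g m a+m≤n = begin
    (n C (a + m)) * (((a + m) C a) * g) ≡⟨ *-assoc (n C (a + m)) _ _ ⟨
    (n C (a + m)) * ((a + m) C a) * g   ≡⟨ cong (_* g) (nCa*[n∸a]Cb≡nC[a+b]*[a+b]Ca n a m a+m≤n) ⟨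
    (n C a) * ((n ∸ a) C m) * g         ≡⟨ solve 3 (λ x y z → x :* y :* z := x :* z :* y) refl (n C a) ((n ∸ a) C m) g ⟩
    (n C a) * g * ((n ∸ a) C m) ∎

  bellCoeff : ℕ → List ℕ → ℕ
  bellCoeff j [] = 1
  bellCoeff j (x ∷ is) = ((j * x + wsumFrom (suc j) is) C (j * x)) * unorderedBlocks j x * bellCoeff (suc j) is

  bellCoeff*denomFrom≡wsumFrom! : ∀ j is → .{{NonZero j}} → bellCoeff j is * denomFrom j is ≡ (wsumFrom j is) !
  bellCoeff*denomFrom≡wsumFrom! j [] = refl
  bellCoeff*denomFrom≡wsumFrom! j (x ∷ is) = begin
    c * unorderedBlocks j x * bellCoeff (suc j) is * (x ! * (j !) ^ x * denomFrom (suc j) is)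
      ≡⟨ solve 6 (λ b k c f p d → b :* k :* c :* (f :* p :* d) := b :* ((f :* k) :* p) :* (c :* d)) refl
               c (unorderedBlocks j x) (bellCoeff (suc j) is) (x !) ((j !) ^ x) (denomFrom (suc j) is) ⟩
    c * (x ! * unorderedBlocks j x * (j !) ^ x) * (bellCoeff (suc j) is * denomFrom (suc j) is)
      ≡⟨ cong₂ (λ u v → c * (u * (j !) ^ x) * v) (x!*unorderedBlocks≡orderedBlocks j x) (bellCoeff*denomFrom≡wsumFrom! (suc j) is) ⟩
    c * (orderedBlocks j x * (j !) ^ x) * w !
      ≡⟨ cong (λ u → c * u * w !) (orderedBlocks*j!^x≡[j*x]! j x) ⟩
    c * (j * x) ! * w !
      ≡⟨ *-assoc c _ _ ⟩
    c * ((j * x) ! * w !)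
      ≡⟨ [m+n]Cm*[m!*n!]≡[m+n]! (j * x) w ⟩
    (j * x + w) ! ∎
    where
    w = wsumFrom (suc j) is
    c = (j * x + w) C (j * x)

  denomFrom≢0 : ∀ j is → .{{NonZero j}} → NonZero (denomFrom j is)
  denomFrom≢0 j [] = _
  denomFrom≢0 j (x ∷ is) = m*n≢0 _ _ {{m*n≢0 _ _ {{x !≢0}} {{m^n≢0 (j !) x {{j !≢0}}}}}} {{denomFrom≢0 (suc j) is}}

  wsumFrom!div-denomFrom≡bellCoeff : ∀ j is → .{{NonZero j}} → ((wsumFrom j is) !) div denomFrom j is ≡ bellCoeff j is
  wsumFrom!div-denomFrom≡bellCoeff j is = begin
    ((wsumFrom j is) !) div d                     ≡⟨ div≡/ ((wsumFrom j is) !) d {{denomFrom≢0 j is}} ⟩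
    ((wsumFrom j is) ! / d) {{denomFrom≢0 j is}}  ≡⟨ cong (λ t → (t / d) {{denomFrom≢0 j is}}) (bellCoeff*denomFrom≡wsumFrom! j is) ⟨
    (bellCoeff j is * d / d) {{denomFrom≢0 j is}} ≡⟨ m*n/n≡m (bellCoeff j is) d {{denomFrom≢0 j is}} ⟩
    bellCoeff j is ∎
    where
    d = denomFrom j is
    div≡/ : ∀ a b → .{{_ : NonZero b}} → a div b ≡ a / b
    div≡/ a (suc b) = refl

  +≡ᵇ-shift : ∀ a s k → a ≤ k → (a + s ≡ᵇ k) ≡ (s ≡ᵇ k ∸ a)
  +≡ᵇ-shift zero s k _ = refl
  +≡ᵇ-shift (suc a) s (suc k) (s≤s a≤k) = +≡ᵇ-shift a s k a≤k

  +≡ᵇ-false : ∀ a s k → k < a → (a + s ≡ᵇ k) ≡ false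
  +≡ᵇ-false (suc a) s zero _ = refl
  +≡ᵇ-false (suc a) s (suc k) (s≤s k<a) = +≡ᵇ-false a s k k<a

  ≡ᵇ≡true⇒≡ : ∀ {m n} → (m ≡ᵇ n) ≡ true → m ≡ n
  ≡ᵇ≡true⇒≡ {m} {n} eq = ≡ᵇ⇒≡ m n (subst T (sym eq) tt)

open Combinatorics

module Sequences {c ℓ : Level} (R : CommutativeRing c ℓ) where

  open import Data.Nat as ℕ using (zero; _<_; _≤?_; _<?_; _≟_; _!)
  open import Data.Nat.Combinatorics using (nCk+nC[k+1]≡[n+1]C[k+1])
  open import Data.Nat.Combinatorics.Specification using (k>n⇒nCk≡0)
  import Data.Nat.Properties as ℕ
  open import Data.Maybe using (nothing)
  open import Data.Bool using (Bool; true; false; if_then_else_; _∧_)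
  open import Data.Bool.Properties using (∧-conicalʳ; ∧-zeroʳ)
  open import Data.List using (List; []; _∷_; map; _++_; concatMap; applyUpTo; upTo; filterᵇ)
  open import Data.List.Properties using (map-∘)
  open import Data.Product using (_×_; _,_)
  open import Data.Sum using (_⊎_; inj₁; inj₂)
  open import Data.Empty using (⊥-elim)
  open import Relation.Nullary using (Dec; yes; no; ¬_)
  open import Relation.Nullary.Decidable using (_×-dec_)
  open import Relation.Binary.PropositionalEquality as P using (_≡_; _≢_)
  open CommutativeRing R
  open import Relation.Binary.Reasoning.Setoid setoid
  open import Algebra.Solver.Ring.NaturalCoefficients commutativeSemiring (λ _ _ → nothing)

  ι : ℕ → Carrier
  ι = ofℕ R

  ι-1 : ι 1 ≈ 1#
  ι-1 = +-identityʳ 1#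

  ι-+ : ∀ a b → ι (a ℕ.+ b) ≈ ι a + ι b
  ι-+ zero b = sym (+-identityˡ _)
  ι-+ (suc a) b = trans (+-congˡ (ι-+ a b)) (sym (+-assoc _ _ _))

  ι-* : ∀ a b → ι (a ℕ.* b) ≈ ι a * ι b
  ι-* zero b = sym (zeroˡ _)
  ι-* (suc a) b = begin
    ι (b ℕ.+ a ℕ.* b) ≈⟨ ι-+ b (a ℕ.* b) ⟩
    ι b + ι (a ℕ.* b) ≈⟨ +-congˡ (ι-* a b) ⟩
    ι b + ι a * ι b   ≈⟨ solve 2 (λ x y → y :+ x :* y := (con 1 :+ x) :* y) refl (ι a) (ι b) ⟩
    (1# + ι a) * ι b ∎

  ι-≡ : ∀ {a b} → a ≡ b → ι a ≈ ι b
  ι-≡ P.refl = refl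

  ∑< : (ℕ → Carrier) → ℕ → Carrier
  ∑< f zero = 0#
  ∑< f (suc n) = ∑< f n + f n

  ∑<-cong< : ∀ {f g} n → (∀ i → i < n → f i ≈ g i) → ∑< f n ≈ ∑< g n
  ∑<-cong< zero eq = refl
  ∑<-cong< (suc n) eq = +-cong (∑<-cong< n (λ i i<n → eq i (ℕ.m<n⇒m<1+n i<n))) (eq n ℕ.≤-refl)

  ∑<-cong : ∀ {f g} n → (∀ i → f i ≈ g i) → ∑< f n ≈ ∑< g n
  ∑<-cong n eq = ∑<-cong< n (λ i _ → eq i)

  ∑<-zero : ∀ {f} n → (∀ i → i < n → f i ≈ 0#) → ∑< f n ≈ 0#
  ∑<-zero zero f≈0 = refl
  ∑<-zero (suc n) f≈0 = trans (+-cong (∑<-zero n (λ i i<n → f≈0 i (ℕ.m<n⇒m<1+n i<n))) (f≈0 n ℕ.≤-refl)) (+-identityˡ _)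

  ∑<-+ : ∀ (f g : ℕ → Carrier) n → ∑< (λ i → f i + g i) n ≈ ∑< f n + ∑< g n
  ∑<-+ f g zero = sym (+-identityˡ _)
  ∑<-+ f g (suc n) = trans (+-congʳ (∑<-+ f g n)) (solve 4 (λ a b c d → (a :+ b) :+ (c :+ d) := (a :+ c) :+ (b :+ d)) refl _ _ _ _)

  ∑<-*ˡ : ∀ a (f : ℕ → Carrier) n → a * ∑< f n ≈ ∑< (λ i → a * f i) n
  ∑<-*ˡ a f zero = zeroʳ a
  ∑<-*ˡ a f (suc n) = trans (distribˡ a _ _) (+-congʳ (∑<-*ˡ a f n))

  ∑<-*ʳ : ∀ (f : ℕ → Carrier) n a → ∑< f n * a ≈ ∑< (λ i → f i * a) n
  ∑<-*ʳ f zero a = zeroˡ a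
  ∑<-*ʳ f (suc n) a = trans (distribʳ a _ _) (+-congʳ (∑<-*ʳ f n a))

  ∑<-suc : ∀ (f : ℕ → Carrier) n → ∑< f (suc n) ≈ f 0 + ∑< (λ i → f (suc i)) n
  ∑<-suc f zero = trans (+-identityˡ _) (sym (+-identityʳ _))
  ∑<-suc f (suc n) = trans (+-congʳ (∑<-suc f n)) (+-assoc _ _ _)

  ∑<-split : ∀ (f : ℕ → Carrier) a n → ∑< f (a ℕ.+ n) ≈ ∑< f a + ∑< (λ i → f (a ℕ.+ i)) n
  ∑<-split f a zero = trans (reflexive (P.cong (∑< f) (ℕ.+-identityʳ a))) (sym (+-identityʳ _))
  ∑<-split f a (suc n) = begin
    ∑< f (a ℕ.+ suc n)                                 ≈⟨ reflexive (P.cong (∑< f) (ℕ.+-suc a n)) ⟩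
    ∑< f (a ℕ.+ n) + f (a ℕ.+ n)                       ≈⟨ +-congʳ (∑<-split f a n) ⟩
    ∑< f a + ∑< (λ i → f (a ℕ.+ i)) n + f (a ℕ.+ n)    ≈⟨ +-assoc _ _ _ ⟩
    ∑< f a + ∑< (λ i → f (a ℕ.+ i)) (suc n) ∎

  ∑<-swap : ∀ (f : ℕ → ℕ → Carrier) n m → ∑< (λ i → ∑< (f i) m) n ≈ ∑< (λ k → ∑< (λ i → f i k) n) m
  ∑<-swap f zero m = sym (∑<-zero m (λ _ _ → refl))
  ∑<-swap f (suc n) m = begin
    ∑< (λ i → ∑< (f i) m) n + ∑< (f n) m               ≈⟨ +-congʳ (∑<-swap f n m) ⟩
    ∑< (λ k → ∑< (λ i → f i k) n) m + ∑< (f n) m       ≈⟨ ∑<-+ (λ k → ∑< (λ i → f i k) n) (f n) m ⟨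
    ∑< (λ k → ∑< (λ i → f i k) (suc n)) m ∎

  ∑<-truncate : ∀ (f : ℕ → Carrier) a n → a ≤ n → (∀ i → a ≤ i → f i ≈ 0#) → ∑< f n ≈ ∑< f a
  ∑<-truncate f a n a≤n f≈0 = begin
    ∑< f n                                        ≈⟨ reflexive (P.cong (∑< f) (P.sym (ℕ.m+[n∸m]≡n a≤n))) ⟩
    ∑< f (a ℕ.+ (n ∸ a))                          ≈⟨ ∑<-split f a (n ∸ a) ⟩
    ∑< f a + ∑< (λ i → f (a ℕ.+ i)) (n ∸ a)       ≈⟨ +-congˡ (∑<-zero (n ∸ a) (λ i _ → f≈0 (a ℕ.+ i) (ℕ.m≤m+n a i))) ⟩
    ∑< f a + 0#                                   ≈⟨ +-identityʳ _ ⟩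
    ∑< f a ∎

  ∑<-single : ∀ (f : ℕ → Carrier) n i₀ → i₀ < n → (∀ i → i < n → i ≢ i₀ → f i ≈ 0#) → ∑< f n ≈ f i₀
  ∑<-single f (suc n) i₀ i₀<1+n f≈0 with i₀ ≟ n
  ... | yes P.refl = trans (+-congʳ (∑<-zero n (λ i i<n → f≈0 i (ℕ.m<n⇒m<1+n i<n) (ℕ.<⇒≢ i<n)))) (+-identityˡ _)
  ... | no i₀≢n = trans (+-cong (∑<-single f n i₀ (ℕ.≤∧≢⇒< (ℕ.≤-pred i₀<1+n) i₀≢n) (λ i i<n → f≈0 i (ℕ.m<n⇒m<1+n i<n)))
                                (f≈0 n ℕ.≤-refl (λ n≡i₀ → i₀≢n (P.sym n≡i₀))))
                        (+-identityʳ _)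

  ∑<-pascal : ∀ (T : ℕ → Carrier) L m →
    ∑< (λ k → ι (suc L C k) * T k) (suc m) ≈ ∑< (λ k → ι (L C k) * T k) (suc m) + ∑< (λ k → ι (L C k) * T (suc k)) m
  ∑<-pascal T L m = begin
    ∑< (λ k → ι (suc L C k) * T k) (suc m)
      ≈⟨ ∑<-suc (λ k → ι (suc L C k) * T k) m ⟩
    ι 1 * T 0 + ∑< (λ k → ι (suc L C suc k) * T (suc k)) m
      ≈⟨ +-congˡ (∑<-cong m (λ k → *-congʳ (ι-≡ (nCk+nC[k+1]≡[n+1]C[k+1] L k)))) ⟨
    ι 1 * T 0 + ∑< (λ k → ι ((L C k) ℕ.+ (L C suc k)) * T (suc k)) m
      ≈⟨ +-congˡ (trans (∑<-cong m (λ k → trans (*-congʳ (ι-+ (L C k) (L C suc k))) (distribʳ _ _ _))) (∑<-+ _ _ m)) ⟩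
    ι 1 * T 0 + (∑< (λ k → ι (L C k) * T (suc k)) m + ∑< (λ k → ι (L C suc k) * T (suc k)) m)
      ≈⟨ solve 3 (λ a b c → a :+ (b :+ c) := (a :+ c) :+ b) refl _ _ _ ⟩
    (ι (L C 0) * T 0 + ∑< (λ k → ι (L C suc k) * T (suc k)) m) + ∑< (λ k → ι (L C k) * T (suc k)) m
      ≈⟨ +-congʳ (∑<-suc (λ k → ι (L C k) * T k) m) ⟨
    ∑< (λ k → ι (L C k) * T k) (suc m) + ∑< (λ k → ι (L C k) * T (suc k)) m ∎

  sumTo≈∑< : ∀ (f : ℕ → Carrier) n → sumTo R f n ≈ ∑< (λ k → f (suc k)) n
  sumTo≈∑< f zero = refl
  sumTo≈∑< f (suc n) = +-congʳ (sumTo≈∑< f n)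

  sumTo-cong : ∀ {f g : ℕ → Carrier} n → (∀ i → f i ≈ g i) → sumTo R f n ≈ sumTo R g n
  sumTo-cong zero f≈g = refl
  sumTo-cong (suc n) f≈g = +-cong (sumTo-cong n f≈g) (f≈g (suc n))

  sumTo-*ˡ : ∀ a (f : ℕ → Carrier) n → a * sumTo R f n ≈ sumTo R (λ i → a * f i) n
  sumTo-*ˡ a f zero = zeroʳ a
  sumTo-*ˡ a f (suc n) = trans (distribˡ a _ _) (+-congʳ (sumTo-*ˡ a f n))

  sumList-++ : ∀ {A : Set} (f : A → Carrier) xs ys → sumList R (map f (xs ++ ys)) ≈ sumList R (map f xs) + sumList R (map f ys)
  sumList-++ f [] ys = sym (+-identityˡ _)
  sumList-++ f (x ∷ xs) ys = trans (+-congˡ (sumList-++ f xs ys)) (sym (+-assoc _ _ _))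

  sumList-concatMap : ∀ {A B : Set} (f : B → Carrier) (g : A → List B) xs →
    sumList R (map f (concatMap g xs)) ≈ sumList R (map (λ x → sumList R (map f (g x))) xs)
  sumList-concatMap f g [] = refl
  sumList-concatMap f g (x ∷ xs) = trans (sumList-++ f (g x) (concatMap g xs)) (+-congˡ (sumList-concatMap f g xs))

  sumList-cong : ∀ {A : Set} {f g : A → Carrier} xs → (∀ x → f x ≈ g x) → sumList R (map f xs) ≈ sumList R (map g xs)
  sumList-cong [] f≈g = refl
  sumList-cong (x ∷ xs) f≈g = +-cong (f≈g x) (sumList-cong xs f≈g)

  sumList-*ˡ : ∀ {A : Set} k (f : A → Carrier) xs → sumList R (map (λ x → k * f x) xs) ≈ k * sumList R (map f xs)
  sumList-*ˡ k f [] = sym (zeroʳ k)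
  sumList-*ˡ k f (x ∷ xs) = trans (+-congˡ (sumList-*ˡ k f xs)) (sym (distribˡ _ _ _))

  sumList-zero : ∀ {A : Set} (f : A → Carrier) xs → (∀ x → f x ≈ 0#) → sumList R (map f xs) ≈ 0#
  sumList-zero f [] f≈0 = refl
  sumList-zero f (x ∷ xs) f≈0 = trans (+-cong (f≈0 x) (sumList-zero f xs f≈0)) (+-identityˡ _)

  sumList-applyUpTo : ∀ (f : ℕ → Carrier) g n → sumList R (map f (applyUpTo g n)) ≈ ∑< (λ i → f (g i)) n
  sumList-applyUpTo f g zero = refl
  sumList-applyUpTo f g (suc n) = trans (+-congˡ (sumList-applyUpTo f (λ i → g (suc i)) n)) (sym (∑<-suc (λ i → f (g i)) n))

  sumList-filterᵇ : ∀ {A : Set} (p : A → Bool) (f : A → Carrier) xs →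
    sumList R (map f (filterᵇ p xs)) ≈ sumList R (map (λ x → if p x then f x else 0#) xs)
  sumList-filterᵇ p f [] = refl
  sumList-filterᵇ p f (x ∷ xs) with p x
  ... | true = +-congˡ (sumList-filterᵇ p f xs)
  ... | false = trans (sumList-filterᵇ p f xs) (sym (+-identityˡ _))

  guard : {A : Set} → Dec A → Carrier → Carrier
  guard (yes _) u = u
  guard (no _) u = 0#

  guard-yes : ∀ {A : Set} (d : Dec A) u → A → guard d u ≈ u
  guard-yes (yes _) u a = refl
  guard-yes (no ¬a) u a = ⊥-elim (¬a a)

  guard-no : ∀ {A : Set} (d : Dec A) u → ¬ A → guard d u ≈ 0#
  guard-no (yes a) u ¬a = ⊥-elim (¬a a)
  guard-no (no _) u _ = refl

  guard-⇔ : ∀ {A B : Set} (d : Dec A) (e : Dec B) u → (A → B) → (B → A) → guard d u ≈ guard e u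
  guard-⇔ (yes a) e u A→B B→A = sym (guard-yes e u (A→B a))
  guard-⇔ (no ¬a) e u A→B B→A = sym (guard-no e u (λ b → ¬a (B→A b)))

  Seq : Set c
  Seq = ℕ → Carrier

  infixl 7 _⊛_
  infixr 8 _^⊛_

  _⊛_ : Seq → Seq → Seq
  (a ⊛ b) n = ∑< (λ m → ι (n C m) * a m * b (n ∸ m)) (suc n)

  δ : Seq
  δ zero = 1#
  δ (suc _) = 0#

  _^⊛_ : Seq → ℕ → Seq
  a ^⊛ zero = δ
  a ^⊛ suc k = a ^⊛ k ⊛ a

  ⊛-cong : ∀ {a a′ b b′} n → (∀ m → m ≤ n → a m ≈ a′ m) → (∀ m → m ≤ n → b m ≈ b′ m) → (a ⊛ b) n ≈ (a′ ⊛ b′) n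
  ⊛-cong n a≈a′ b≈b′ = ∑<-cong< (suc n) (λ m m<1+n → *-cong (*-congˡ (a≈a′ m (ℕ.≤-pred m<1+n))) (b≈b′ (n ∸ m) (ℕ.m∸n≤m n m)))

  ⊛-congˡ : ∀ {a a′} b n → (∀ m → m ≤ n → a m ≈ a′ m) → (a ⊛ b) n ≈ (a′ ⊛ b) n
  ⊛-congˡ b n a≈a′ = ⊛-cong {b = b} {b′ = b} n a≈a′ (λ _ _ → refl)

  ⊛-distribˡ : ∀ a b b′ n → (a ⊛ (λ m → b m + b′ m)) n ≈ (a ⊛ b) n + (a ⊛ b′) n
  ⊛-distribˡ a b b′ n = trans (∑<-cong (suc n) (λ m → distribˡ _ _ _)) (∑<-+ _ _ (suc n))

  ⊛-*ˡ : ∀ k a b n → ((λ m → k * a m) ⊛ b) n ≈ k * (a ⊛ b) n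
  ⊛-*ˡ k a b n = trans (∑<-cong (suc n) (λ m → solve 4 (λ i k a b → i :* (k :* a) :* b := k :* (i :* a :* b)) refl _ _ _ _))
                       (sym (∑<-*ˡ k _ (suc n)))

  ⊛-∑<ˡ : ∀ (a : ℕ → Seq) k b n → ((λ m → ∑< (λ x → a x m) k) ⊛ b) n ≈ ∑< (λ x → (a x ⊛ b) n) k
  ⊛-∑<ˡ a k b n = begin
    ∑< (λ m → ι (n C m) * ∑< (λ x → a x m) k * b (n ∸ m)) (suc n)
      ≈⟨ ∑<-cong (suc n) (λ m → trans (*-congʳ (∑<-*ˡ (ι (n C m)) (λ x → a x m) k)) (∑<-*ʳ _ k (b (n ∸ m)))) ⟩
    ∑< (λ m → ∑< (λ x → ι (n C m) * a x m * b (n ∸ m)) k) (suc n)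
      ≈⟨ ∑<-swap (λ m x → ι (n C m) * a x m * b (n ∸ m)) (suc n) k ⟩
    ∑< (λ x → (a x ⊛ b) n) k ∎

  δ-⊛ : ∀ b n → (δ ⊛ b) n ≈ b n
  δ-⊛ b n = begin
    (δ ⊛ b) n                  ≈⟨ ∑<-single _ (suc n) 0 (s≤s z≤n) δ-term≈0 ⟩
    ι (n C 0) * 1# * b (n ∸ 0) ≈⟨ *-congʳ (trans (*-identityʳ _) ι-1) ⟩
    1# * b n                   ≈⟨ *-identityˡ _ ⟩
    b n ∎
    where
    δ-term≈0 : ∀ i → i < suc n → i ≢ 0 → ι (n C i) * δ i * b (n ∸ i) ≈ 0#
    δ-term≈0 zero _ i≢0 = ⊥-elim (i≢0 P.refl)
    δ-term≈0 (suc i) _ _ = trans (*-congʳ (zeroʳ _)) (zeroˡ _)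

  ^⊛-cong : ∀ {a a′} n → (∀ m → m ≤ n → a m ≈ a′ m) → ∀ k {m} → m ≤ n → (a ^⊛ k) m ≈ (a′ ^⊛ k) m
  ^⊛-cong n a≈a′ zero m≤n = refl
  ^⊛-cong n a≈a′ (suc k) {m} m≤n =
    ⊛-cong m (λ i i≤m → ^⊛-cong n a≈a′ k (ℕ.≤-trans i≤m m≤n)) (λ i i≤m → a≈a′ i (ℕ.≤-trans i≤m m≤n))

  0^⊛suc : ∀ a → (∀ m → a m ≈ 0#) → ∀ k n → (a ^⊛ suc k) n ≈ 0#
  0^⊛suc a a≈0 k n = ∑<-zero (suc n) (λ m _ → trans (*-congˡ (a≈0 (n ∸ m))) (zeroʳ _))

  module Bell (z : Seq) where

    single : ℕ → Seq
    single j m = guard (m ≟ j) (z j)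

    -- The closed form of single j ^⊛ x ⊛ Y.
    singlePow⊛ : ℕ → ℕ → Seq → Seq
    singlePow⊛ j x Y n = guard (j ℕ.* x ≤? n) (ι ((n C (j ℕ.* x)) ℕ.* orderedBlocks j x) * (pow R (z j) x * Y (n ∸ j ℕ.* x)))

    singlePow⊛-zero : ∀ j Y n → singlePow⊛ j 0 Y n ≈ Y n
    singlePow⊛-zero j Y n rewrite ℕ.*-zeroʳ j = begin
      ι ((n C 0) ℕ.* 1) * (1# * Y n) ≈⟨ *-cong ι-1 (*-identityˡ _) ⟩
      1# * Y n                       ≈⟨ *-identityˡ _ ⟩
      Y n ∎

    singlePow⊛-⊛single : ∀ j x Y n → (singlePow⊛ j x Y ⊛ single j) n ≈ singlePow⊛ j (suc x) Y n
    singlePow⊛-⊛single j x Y n with j ≤? n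
    ... | no j≰n = trans (∑<-zero (suc n) (λ i _ → trans (*-congˡ (guard-no ((n ∸ i) ≟ j) _ (n∸i≢j i))) (zeroʳ _)))
                         (sym (guard-no (j ℕ.* suc x ≤? n) _ (λ j[1+x]≤n → j≰n (ℕ.≤-trans (ℕ.m≤m*n j (suc x)) j[1+x]≤n))))
      where
      n∸i≢j : ∀ i → n ∸ i ≢ j
      n∸i≢j i n∸i≡j = j≰n (P.subst (_≤ n) n∸i≡j (ℕ.m∸n≤m n i))
    ... | yes j≤n = begin
      (singlePow⊛ j x Y ⊛ single j) n
        ≈⟨ ∑<-single _ (suc n) (n ∸ j) (s≤s (ℕ.m∸n≤m n j)) off-diagonal≈0 ⟩
      ι (n C (n ∸ j)) * singlePow⊛ j x Y (n ∸ j) * single j (n ∸ (n ∸ j))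
        ≈⟨ *-congˡ (guard-yes ((n ∸ (n ∸ j)) ≟ j) _ (ℕ.m∸[m∸n]≡n j≤n)) ⟩
      ι (n C (n ∸ j)) * singlePow⊛ j x Y (n ∸ j) * z j
        ≈⟨ diagonal (j ℕ.* x ≤? n ∸ j) (j ℕ.* suc x ≤? n) ⟩
      singlePow⊛ j (suc x) Y n ∎
      where
      A = j ℕ.* x
      j[1+x]≡A+j : j ℕ.* suc x ≡ A ℕ.+ j
      j[1+x]≡A+j = P.trans (ℕ.*-suc j x) (ℕ.+-comm j A)
      off-diagonal≈0 : ∀ i → i < suc n → i ≢ n ∸ j → ι (n C i) * singlePow⊛ j x Y i * single j (n ∸ i) ≈ 0#
      off-diagonal≈0 i i<1+n i≢n∸j = trans (*-congˡ (guard-no ((n ∸ i) ≟ j) _ n∸i≢j)) (zeroʳ _)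
        where
        n∸i≢j : n ∸ i ≢ j
        n∸i≢j n∸i≡j = i≢n∸j (P.trans (P.sym (ℕ.m∸[m∸n]≡n (ℕ.≤-pred i<1+n))) (P.cong (n ∸_) n∸i≡j))
      diagonal : (d : Dec (A ≤ n ∸ j)) (e : Dec (j ℕ.* suc x ≤ n)) →
        ι (n C (n ∸ j)) * guard d (ι (((n ∸ j) C A) ℕ.* orderedBlocks j x) * (pow R (z j) x * Y (n ∸ j ∸ A))) * z j
          ≈ guard e (ι ((n C (j ℕ.* suc x)) ℕ.* orderedBlocks j (suc x)) * (pow R (z j) (suc x) * Y (n ∸ j ℕ.* suc x)))
      diagonal (no _) (no _) = trans (*-congʳ (zeroʳ _)) (zeroˡ _)
      diagonal (yes A≤n∸j) (no j[1+x]≰n) = ⊥-elim (j[1+x]≰n (P.subst (_≤ n) (P.sym j[1+x]≡A+j) (ℕ.m≤o∸n⇒m+n≤o A j≤n A≤n∸j)))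
      diagonal (no A≰n∸j) (yes j[1+x]≤n) = ⊥-elim (A≰n∸j (ℕ.m+n≤o⇒m≤o∸n A (P.subst (_≤ n) j[1+x]≡A+j j[1+x]≤n)))
      diagonal (yes _) (yes j[1+x]≤n) = begin
        ι (n C (n ∸ j)) * (ι (((n ∸ j) C A) ℕ.* orderedBlocks j x) * (pow R (z j) x * Y (n ∸ j ∸ A))) * z j
          ≈⟨ solve 5 (λ b1 b2 p y zj → b1 :* (b2 :* (p :* y)) :* zj := b1 :* b2 :* (zj :* p :* y)) refl _ _ _ _ _ ⟩
        ι (n C (n ∸ j)) * ι (((n ∸ j) C A) ℕ.* orderedBlocks j x) * (z j * pow R (z j) x * Y (n ∸ j ∸ A))
          ≈⟨ *-cong (sym (ι-* (n C (n ∸ j)) _)) (*-congˡ (reflexive (P.cong Y n∸j∸A≡n∸j[1+x]))) ⟩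
        ι ((n C (n ∸ j)) ℕ.* (((n ∸ j) C A) ℕ.* orderedBlocks j x)) * (z j * pow R (z j) x * Y (n ∸ j ℕ.* suc x))
          ≈⟨ *-congʳ (ι-≡ (choose-orderedBlocks-suc n j x j≤n j[1+x]≤n)) ⟩
        ι ((n C (j ℕ.* suc x)) ℕ.* orderedBlocks j (suc x)) * (pow R (z j) (suc x) * Y (n ∸ j ℕ.* suc x)) ∎
        where
        n∸j∸A≡n∸j[1+x] : n ∸ j ∸ A ≡ n ∸ j ℕ.* suc x
        n∸j∸A≡n∸j[1+x] = P.trans (ℕ.∸-+-assoc n j A) (P.cong (n ∸_) (P.sym (ℕ.*-suc j x)))

    singlePow⊛-⊛ : ∀ j x Y h n → (singlePow⊛ j x Y ⊛ h) n ≈ singlePow⊛ j x (Y ⊛ h) n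
    singlePow⊛-⊛ j x Y h n = by-cases (j ℕ.* x ≤? n)
      where
      A = j ℕ.* x
      p = pow R (z j) x
      κ = ι ((n C A) ℕ.* orderedBlocks j x)
      f : ℕ → Carrier
      f m = ι (n C m) * singlePow⊛ j x Y m * h (n ∸ m)
      f-below : ∀ m → ¬ (A ≤ m) → f m ≈ 0#
      f-below m A≰m = trans (*-congʳ (trans (*-congˡ (guard-no (A ≤? m) _ A≰m)) (zeroʳ _))) (zeroˡ _)
      by-cases : Dec (A ≤ n) → (singlePow⊛ j x Y ⊛ h) n ≈ singlePow⊛ j x (Y ⊛ h) n
      by-cases (no A≰n) = trans (∑<-zero (suc n) (λ m m<1+n → f-below m (λ A≤m → A≰n (ℕ.≤-trans A≤m (ℕ.≤-pred m<1+n)))))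
                                (sym (guard-no (A ≤? n) _ A≰n))
      by-cases (yes A≤n) = begin
        ∑< f (suc n)                                         ≈⟨ reflexive (P.cong (∑< f) 1+n≡A+[1+n∸A]) ⟩
        ∑< f (A ℕ.+ suc (n ∸ A))                             ≈⟨ ∑<-split f A (suc (n ∸ A)) ⟩
        ∑< f A + ∑< (λ i → f (A ℕ.+ i)) (suc (n ∸ A))        ≈⟨ +-congʳ (∑<-zero A (λ m m<A → f-below m (ℕ.<⇒≱ m<A))) ⟩
        0# + ∑< (λ i → f (A ℕ.+ i)) (suc (n ∸ A))            ≈⟨ +-identityˡ _ ⟩
        ∑< (λ i → f (A ℕ.+ i)) (suc (n ∸ A))                 ≈⟨ ∑<-cong< (suc (n ∸ A)) shifted-term ⟩
        ∑< (λ i → κ * (p * (ι ((n ∸ A) C i) * Y i * h (n ∸ A ∸ i)))) (suc (n ∸ A))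
                                                             ≈⟨ ∑<-*ˡ _ _ (suc (n ∸ A)) ⟨
        κ * ∑< (λ i → p * (ι ((n ∸ A) C i) * Y i * h (n ∸ A ∸ i))) (suc (n ∸ A))
                                                             ≈⟨ *-congˡ (∑<-*ˡ _ _ (suc (n ∸ A))) ⟨
        κ * (p * (Y ⊛ h) (n ∸ A))                            ≈⟨ guard-yes (A ≤? n) _ A≤n ⟨
        singlePow⊛ j x (Y ⊛ h) n ∎
        where
        1+n≡A+[1+n∸A] : suc n ≡ A ℕ.+ suc (n ∸ A)
        1+n≡A+[1+n∸A] = P.trans (P.cong suc (P.sym (ℕ.m+[n∸m]≡n A≤n))) (P.sym (ℕ.+-suc A (n ∸ A)))
        shifted-term : ∀ i → i < suc (n ∸ A) → f (A ℕ.+ i) ≈ κ * (p * (ι ((n ∸ A) C i) * Y i * h (n ∸ A ∸ i)))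
        shifted-term i i<1+n∸A = begin
          ι (n C (A ℕ.+ i)) * guard (A ≤? A ℕ.+ i) (ι (((A ℕ.+ i) C A) ℕ.* orderedBlocks j x) * (p * Y (A ℕ.+ i ∸ A))) * h (n ∸ (A ℕ.+ i))
            ≈⟨ *-cong (*-congˡ (guard-yes (A ≤? A ℕ.+ i) _ (ℕ.m≤m+n A i))) (reflexive (P.cong h (P.sym (ℕ.∸-+-assoc n A i)))) ⟩
          ι (n C (A ℕ.+ i)) * (ι (((A ℕ.+ i) C A) ℕ.* orderedBlocks j x) * (p * Y (A ℕ.+ i ∸ A))) * h (n ∸ A ∸ i)
            ≈⟨ *-congʳ (*-congˡ (*-congˡ (*-congˡ (reflexive (P.cong Y (ℕ.m+n∸m≡n A i)))))) ⟩
          ι (n C (A ℕ.+ i)) * (ι (((A ℕ.+ i) C A) ℕ.* orderedBlocks j x) * (p * Y i)) * h (n ∸ A ∸ i)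
            ≈⟨ solve 5 (λ a b p y hh → a :* (b :* (p :* y)) :* hh := a :* b :* (p :* y :* hh)) refl _ _ _ _ _ ⟩
          ι (n C (A ℕ.+ i)) * ι (((A ℕ.+ i) C A) ℕ.* orderedBlocks j x) * (p * Y i * h (n ∸ A ∸ i))
            ≈⟨ *-congʳ (sym (ι-* (n C (A ℕ.+ i)) _)) ⟩
          ι ((n C (A ℕ.+ i)) ℕ.* (((A ℕ.+ i) C A) ℕ.* orderedBlocks j x)) * (p * Y i * h (n ∸ A ∸ i))
            ≈⟨ *-congʳ (ι-≡ (nC[a+m]*[[a+m]Ca*g]≡nCa*g*[n∸a]Cm n A (orderedBlocks j x) i A+i≤n)) ⟩
          ι ((n C A) ℕ.* orderedBlocks j x ℕ.* ((n ∸ A) C i)) * (p * Y i * h (n ∸ A ∸ i))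
            ≈⟨ *-congʳ (ι-* ((n C A) ℕ.* orderedBlocks j x) ((n ∸ A) C i)) ⟩
          κ * ι ((n ∸ A) C i) * (p * Y i * h (n ∸ A ∸ i))
            ≈⟨ solve 5 (λ a b p y hh → a :* b :* (p :* y :* hh) := a :* (p :* (b :* y :* hh))) refl _ _ _ _ _ ⟩
          κ * (p * (ι ((n ∸ A) C i) * Y i * h (n ∸ A ∸ i))) ∎
          where
          A+i≤n : A ℕ.+ i ≤ n
          A+i≤n = P.subst (_≤ n) (ℕ.+-comm i A) (ℕ.m≤o∸n⇒m+n≤o i A≤n (ℕ.≤-pred i<1+n∸A))

    [single+h]^⊛-binomial : ∀ j h k n →
      ((λ m → single j m + h m) ^⊛ k) n ≈ ∑< (λ x → ι (k C x) * singlePow⊛ j x (h ^⊛ (k ∸ x)) n) (suc k)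
    [single+h]^⊛-binomial j h zero n = begin
      δ n                        ≈⟨ singlePow⊛-zero j δ n ⟨
      singlePow⊛ j 0 δ n         ≈⟨ *-identityˡ _ ⟨
      1# * singlePow⊛ j 0 δ n    ≈⟨ *-congʳ ι-1 ⟨
      ι 1 * singlePow⊛ j 0 δ n   ≈⟨ +-identityˡ _ ⟨
      0# + ι 1 * singlePow⊛ j 0 δ n ∎
    [single+h]^⊛-binomial j h (suc k) n = begin
      (s+h ^⊛ k ⊛ s+h) n
        ≈⟨ ⊛-distribˡ (s+h ^⊛ k) (single j) h n ⟩
      (s+h ^⊛ k ⊛ single j) n + (s+h ^⊛ k ⊛ h) n
        ≈⟨ +-cong (⊛-congˡ (single j) n (λ m _ → [single+h]^⊛-binomial j h k m)) (⊛-congˡ h n (λ m _ → [single+h]^⊛-binomial j h k m)) ⟩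
      (S ⊛ single j) n + (S ⊛ h) n
        ≈⟨ +-cong (expand (single j)) (expand h) ⟩
      ∑< (λ x → ι (k C x) * (singlePow⊛ j x (h ^⊛ (k ∸ x)) ⊛ single j) n) (suc k)
        + ∑< (λ x → ι (k C x) * (singlePow⊛ j x (h ^⊛ (k ∸ x)) ⊛ h) n) (suc k)
        ≈⟨ +-cong (∑<-cong (suc k) (λ x → *-congˡ (singlePow⊛-⊛single j x (h ^⊛ (k ∸ x)) n)))
                  (∑<-cong< (suc k) (λ x x<1+k → *-congˡ (trans (singlePow⊛-⊛ j x (h ^⊛ (k ∸ x)) h n)
                                                                 (reflexive (P.cong (λ t → T′ t x) (1+k∸x≡1+[k∸x] x<1+k)))))) ⟩
      ∑< (λ x → ι (k C x) * T (suc x)) (suc k) + ∑< (λ x → ι (k C x) * T x) (suc k)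
        ≈⟨ +-comm _ _ ⟩
      ∑< (λ x → ι (k C x) * T x) (suc k) + ∑< (λ x → ι (k C x) * T (suc x)) (suc k)
        ≈⟨ +-congʳ (trans (+-congˡ (trans (*-congʳ (ι-≡ (k>n⇒nCk≡0 (ℕ.n<1+n k)))) (zeroˡ _))) (+-identityʳ _)) ⟨
      ∑< (λ x → ι (k C x) * T x) (suc (suc k)) + ∑< (λ x → ι (k C x) * T (suc x)) (suc k)
        ≈⟨ ∑<-pascal T k (suc k) ⟨
      ∑< (λ x → ι (suc k C x) * T x) (suc (suc k)) ∎
      where
      s+h : Seq
      s+h m = single j m + h m
      S : Seq
      S m = ∑< (λ x → ι (k C x) * singlePow⊛ j x (h ^⊛ (k ∸ x)) m) (suc k)
      T′ : ℕ → ℕ → Carrier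
      T′ t x = singlePow⊛ j x (h ^⊛ t) n
      T : ℕ → Carrier
      T x = T′ (suc k ∸ x) x
      1+k∸x≡1+[k∸x] : ∀ {x} → x < suc k → suc (k ∸ x) ≡ suc k ∸ x
      1+k∸x≡1+[k∸x] x<1+k = P.sym (ℕ.+-∸-assoc 1 (ℕ.≤-pred x<1+k))
      expand : ∀ b → (S ⊛ b) n ≈ ∑< (λ x → ι (k C x) * (singlePow⊛ j x (h ^⊛ (k ∸ x)) ⊛ b) n) (suc k)
      expand b = trans (⊛-∑<ˡ (λ x m → ι (k C x) * singlePow⊛ j x (h ^⊛ (k ∸ x)) m) (suc k) b n)
                       (∑<-cong (suc k) (λ x → ⊛-*ˡ (ι (k C x)) (singlePow⊛ j x (h ^⊛ (k ∸ x))) b n))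

    bellTerm : ℕ → ℕ → ℕ → List ℕ → Carrier
    bellTerm j n k is = if (sumL is ℕ.≡ᵇ k) ∧ (wsumFrom j is ℕ.≡ᵇ n) then ι (bellCoeff j is) * monoFrom R z j is else 0#

    -- The part of a Bell sum over the counts (i_j, …, i_{j+len-1}) of parts of sizes j, …, j+len-1,
    -- each count ranging over 0, …, b.
    bellSum : ℕ → ℕ → ℕ → ℕ → ℕ → Carrier
    bellSum j len b n k = sumList R (map (bellTerm j n k) (tuples len b))

    bellTerm-∷ : ∀ j n k x is → x ≤ k → j ℕ.* x ≤ n →
      bellTerm j n k (x ∷ is) ≈ ι ((n C (j ℕ.* x)) ℕ.* unorderedBlocks j x) * (pow R (z j) x * bellTerm (suc j) (n ∸ j ℕ.* x) (k ∸ x) is)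
    bellTerm-∷ j n k x is x≤k jx≤n
      rewrite +≡ᵇ-shift x (sumL is) k x≤k | +≡ᵇ-shift (j ℕ.* x) (wsumFrom (suc j) is) n jx≤n
      with (sumL is ℕ.≡ᵇ k ∸ x) ∧ (wsumFrom (suc j) is ℕ.≡ᵇ n ∸ j ℕ.* x) in eq
    ... | false = sym (trans (*-congˡ (zeroʳ _)) (zeroʳ _))
    ... | true = begin
      ι (((j ℕ.* x ℕ.+ w) C (j ℕ.* x)) ℕ.* unorderedBlocks j x ℕ.* bellCoeff (suc j) is) * (pow R (z j) x * monoFrom R z (suc j) is)
        ≈⟨ *-congʳ (ι-≡ (P.cong (λ t → (t C (j ℕ.* x)) ℕ.* unorderedBlocks j x ℕ.* bellCoeff (suc j) is) jx+w≡n)) ⟩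
      ι ((n C (j ℕ.* x)) ℕ.* unorderedBlocks j x ℕ.* bellCoeff (suc j) is) * (pow R (z j) x * monoFrom R z (suc j) is)
        ≈⟨ *-congʳ (ι-* ((n C (j ℕ.* x)) ℕ.* unorderedBlocks j x) (bellCoeff (suc j) is)) ⟩
      ι ((n C (j ℕ.* x)) ℕ.* unorderedBlocks j x) * ι (bellCoeff (suc j) is) * (pow R (z j) x * monoFrom R z (suc j) is)
        ≈⟨ solve 4 (λ a b p m → a :* b :* (p :* m) := a :* (p :* (b :* m))) refl _ _ _ _ ⟩
      ι ((n C (j ℕ.* x)) ℕ.* unorderedBlocks j x) * (pow R (z j) x * (ι (bellCoeff (suc j) is) * monoFrom R z (suc j) is)) ∎
      where
      w = wsumFrom (suc j) is
      jx+w≡n : j ℕ.* x ℕ.+ w ≡ n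
      jx+w≡n = P.trans (P.cong (j ℕ.* x ℕ.+_) (≡ᵇ≡true⇒≡ (∧-conicalʳ _ _ eq))) (ℕ.m+[n∸m]≡n jx≤n)

    bellTerm-∷-zero : ∀ j n k x is → ¬ (x ≤ k × j ℕ.* x ≤ n) → bellTerm j n k (x ∷ is) ≈ 0#
    bellTerm-∷-zero j n k x is ¬x≤k×jx≤n with x ≤? k | j ℕ.* x ≤? n
    ... | no x≰k | _ rewrite +≡ᵇ-false x (sumL is) k (ℕ.≰⇒> x≰k) = refl
    ... | yes _ | no jx≰n rewrite +≡ᵇ-false (j ℕ.* x) (wsumFrom (suc j) is) n (ℕ.≰⇒> jx≰n) | ∧-zeroʳ (x ℕ.+ sumL is ℕ.≡ᵇ k) = refl
    ... | yes x≤k | yes jx≤n = ⊥-elim (¬x≤k×jx≤n (x≤k , jx≤n))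

    bellSlice : ℕ → ℕ → ℕ → ℕ → ℕ → ℕ → Carrier
    bellSlice j len b n k x = guard (x ≤? k ×-dec j ℕ.* x ≤? n)
      (ι ((n C (j ℕ.* x)) ℕ.* unorderedBlocks j x) * (pow R (z j) x * bellSum (suc j) len b (n ∸ j ℕ.* x) (k ∸ x)))

    bellSum-suc : ∀ j len b n k → bellSum j (suc len) b n k ≈ ∑< (bellSlice j len b n k) (suc b)
    bellSum-suc j len b n k = begin
      sumList R (map (bellTerm j n k) (concatMap (λ x → map (x ∷_) (tuples len b)) (upTo (suc b))))
        ≈⟨ sumList-concatMap (bellTerm j n k) (λ x → map (x ∷_) (tuples len b)) (upTo (suc b)) ⟩
      sumList R (map (λ x → sumList R (map (bellTerm j n k) (map (x ∷_) (tuples len b)))) (upTo (suc b)))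
        ≈⟨ sumList-applyUpTo _ (λ i → i) (suc b) ⟩
      ∑< (λ x → sumList R (map (bellTerm j n k) (map (x ∷_) (tuples len b)))) (suc b)
        ≈⟨ ∑<-cong (suc b) (λ x → trans (reflexive (P.cong (sumList R) (P.sym (map-∘ (tuples len b)))))
                                        (first-entry x (x ≤? k ×-dec j ℕ.* x ≤? n))) ⟩
      ∑< (bellSlice j len b n k) (suc b) ∎
      where
      first-entry : ∀ x (d : Dec (x ≤ k × j ℕ.* x ≤ n)) → sumList R (map (λ is → bellTerm j n k (x ∷ is)) (tuples len b)) ≈
        guard d (ι ((n C (j ℕ.* x)) ℕ.* unorderedBlocks j x) * (pow R (z j) x * bellSum (suc j) len b (n ∸ j ℕ.* x) (k ∸ x)))
      first-entry x (no ¬x≤k×jx≤n) = sumList-zero _ (tuples len b) (λ is → bellTerm-∷-zero j n k x is ¬x≤k×jx≤n)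
      first-entry x (yes (x≤k , jx≤n)) = begin
        sumList R (map (λ is → bellTerm j n k (x ∷ is)) (tuples len b))
          ≈⟨ sumList-cong (tuples len b) (λ is → bellTerm-∷ j n k x is x≤k jx≤n) ⟩
        sumList R (map (λ is → ι ((n C (j ℕ.* x)) ℕ.* unorderedBlocks j x) * (pow R (z j) x * bellTerm (suc j) (n ∸ j ℕ.* x) (k ∸ x) is)) (tuples len b))
          ≈⟨ sumList-*ˡ _ _ (tuples len b) ⟩
        ι ((n C (j ℕ.* x)) ℕ.* unorderedBlocks j x) * sumList R (map (λ is → pow R (z j) x * bellTerm (suc j) (n ∸ j ℕ.* x) (k ∸ x) is) (tuples len b))
          ≈⟨ *-congˡ (sumList-*ˡ _ _ (tuples len b)) ⟩
        ι ((n C (j ℕ.* x)) ℕ.* unorderedBlocks j x) * (pow R (z j) x * bellSum (suc j) len b (n ∸ j ℕ.* x) (k ∸ x)) ∎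

    window : ℕ → ℕ → Seq
    window j len m = guard (j ≤? m ×-dec m <? j ℕ.+ len) (z m)

    window-zero : ∀ j m → window j 0 m ≈ 0#
    window-zero j m = guard-no (j ≤? m ×-dec m <? j ℕ.+ 0) _
                               (λ (j≤m , m<j+0) → ℕ.<⇒≱ m<j+0 (P.subst (_≤ m) (P.sym (ℕ.+-identityʳ j)) j≤m))

    window-suc : ∀ j len m → window j (suc len) m ≈ single j m + window (suc j) len m
    window-suc j len m with m ≟ j
    ... | yes P.refl = begin
      window m (suc len) m   ≈⟨ guard-yes (m ≤? m ×-dec m <? m ℕ.+ suc len) _ (ℕ.≤-refl , ℕ.m<m+n m (s≤s z≤n)) ⟩
      z m                    ≈⟨ +-identityʳ _ ⟨
      z m + 0#               ≈⟨ +-congˡ (guard-no (suc m ≤? m ×-dec m <? suc m ℕ.+ len) _ (λ (1+m≤m , _) → ℕ.<-irrefl P.refl 1+m≤m)) ⟨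
      z m + window (suc m) len m ∎
    ... | no m≢j = trans (guard-⇔ (j ≤? m ×-dec m <? j ℕ.+ suc len) (suc j ≤? m ×-dec m <? suc j ℕ.+ len) (z m)
                            (λ (j≤m , m<j+1+len) → ℕ.≤∧≢⇒< j≤m (λ j≡m → m≢j (P.sym j≡m)) , P.subst (m <_) (ℕ.+-suc j len) m<j+1+len)
                            (λ (j<m , m<1+j+len) → ℕ.<⇒≤ j<m , P.subst (m <_) (P.sym (ℕ.+-suc j len)) m<1+j+len))
                         (sym (+-identityˡ _))

    k!*bellSlice : ∀ len j b n k x → .{{_ : ℕ.NonZero j}} → n ≤ b →
      (∀ n′ k′ → n′ ≤ b → ι (k′ !) * bellSum (suc j) len b n′ k′ ≈ (window (suc j) len ^⊛ k′) n′) →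
      ι (k !) * bellSlice j len b n k x ≈ ι (k C x) * singlePow⊛ j x (window (suc j) len ^⊛ (k ∸ x)) n
    k!*bellSlice len j b n k x n≤b tail = by-cases (x ≤? k) (j ℕ.* x ≤? n)
      where
      B = n C (j ℕ.* x)
      p = pow R (z j) x
      S′ = bellSum (suc j) len b (n ∸ j ℕ.* x) (k ∸ x)
      u = ι (B ℕ.* unorderedBlocks j x) * (p * S′)
      d = x ≤? k ×-dec j ℕ.* x ≤? n
      by-cases : Dec (x ≤ k) → Dec (j ℕ.* x ≤ n) →
        ι (k !) * guard d u ≈ ι (k C x) * singlePow⊛ j x (window (suc j) len ^⊛ (k ∸ x)) n
      by-cases (no x≰k) _ = begin
        ι (k !) * guard d u    ≈⟨ *-congˡ (guard-no d _ (λ (x≤k , _) → x≰k x≤k)) ⟩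
        ι (k !) * 0#                                     ≈⟨ zeroʳ _ ⟩
        0#                                               ≈⟨ zeroˡ _ ⟨
        ι 0 * _                                          ≈⟨ *-congʳ (ι-≡ (k>n⇒nCk≡0 (ℕ.≰⇒> x≰k))) ⟨
        ι (k C x) * _ ∎
      by-cases (yes _) (no jx≰n) = begin
        ι (k !) * guard d u    ≈⟨ *-congˡ (guard-no d _ (λ (_ , jx≤n) → jx≰n jx≤n)) ⟩
        ι (k !) * 0#                                     ≈⟨ zeroʳ _ ⟩
        0#                                               ≈⟨ zeroʳ _ ⟨
        ι (k C x) * 0#                                   ≈⟨ *-congˡ (guard-no (j ℕ.* x ≤? n) _ jx≰n) ⟨
        ι (k C x) * _ ∎
      by-cases (yes x≤k) (yes jx≤n) = begin
        ι (k !) * guard d u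
          ≈⟨ *-congˡ (guard-yes d _ (x≤k , jx≤n)) ⟩
        ι (k !) * (ι (B ℕ.* unorderedBlocks j x) * (p * S′))
          ≈⟨ *-congˡ (*-congʳ (ι-* B (unorderedBlocks j x))) ⟩
        ι (k !) * (ι B * ι (unorderedBlocks j x) * (p * S′))
          ≈⟨ solve 5 (λ f b ub p s → f :* (b :* ub :* (p :* s)) := b :* (f :* ub) :* (p :* s)) refl _ _ _ _ _ ⟩
        ι B * (ι (k !) * ι (unorderedBlocks j x)) * (p * S′)
          ≈⟨ *-congʳ (*-congˡ (sym (ι-* (k !) (unorderedBlocks j x)))) ⟩
        ι B * ι (k ! ℕ.* unorderedBlocks j x) * (p * S′)
          ≈⟨ *-congʳ (*-congˡ (ι-≡ (k!*unorderedBlocks≡kCx*orderedBlocks*[k∸x]! j k x x≤k))) ⟩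
        ι B * ι ((k C x) ℕ.* orderedBlocks j x ℕ.* (k ∸ x) !) * (p * S′)
          ≈⟨ *-congʳ (*-congˡ (trans (ι-* ((k C x) ℕ.* orderedBlocks j x) _) (*-congʳ (ι-* (k C x) _)))) ⟩
        ι B * (ι (k C x) * ι (orderedBlocks j x) * ι ((k ∸ x) !)) * (p * S′)
          ≈⟨ solve 6 (λ b c o f p s → b :* (c :* o :* f) :* (p :* s) := c :* (b :* o :* (p :* (f :* s)))) refl _ _ _ _ _ _ ⟩
        ι (k C x) * (ι B * ι (orderedBlocks j x) * (p * (ι ((k ∸ x) !) * S′)))
          ≈⟨ *-congˡ (*-cong (sym (ι-* B _)) (*-congˡ (tail (n ∸ j ℕ.* x) (k ∸ x) (ℕ.≤-trans (ℕ.m∸n≤m n (j ℕ.* x)) n≤b)))) ⟩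
        ι (k C x) * (ι (B ℕ.* orderedBlocks j x) * (p * (window (suc j) len ^⊛ (k ∸ x)) (n ∸ j ℕ.* x)))
          ≈⟨ *-congˡ (guard-yes (j ℕ.* x ≤? n) _ jx≤n) ⟨
        ι (k C x) * singlePow⊛ j x (window (suc j) len ^⊛ (k ∸ x)) n ∎

    -- Induction on the number of part sizes j, j+1, … still to be distributed; the parts of size j
    -- are split off by the binomial theorem for (single j + window (1+j) len) ^⊛ k.
    k!*bellSum≈window^⊛ : ∀ len j → .{{_ : ℕ.NonZero j}} → ∀ b n k → n ≤ b → ι (k !) * bellSum j len b n k ≈ (window j len ^⊛ k) n
    k!*bellSum≈window^⊛ zero j b zero zero _ = trans (*-cong ι-1 (trans (+-identityʳ _) (trans (*-congʳ ι-1) (*-identityˡ _)))) (*-identityˡ _)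
    k!*bellSum≈window^⊛ zero j b (suc n) zero _ = trans (*-congˡ (+-identityʳ _)) (zeroʳ _)
    k!*bellSum≈window^⊛ zero j b n (suc k) _ = trans (trans (*-congˡ (+-identityʳ _)) (zeroʳ _)) (sym (0^⊛suc (window j 0) (window-zero j) k n))
    k!*bellSum≈window^⊛ (suc len) j b n k n≤b = begin
      ι (k !) * bellSum j (suc len) b n k   ≈⟨ *-congˡ (bellSum-suc j len b n k) ⟩
      ι (k !) * ∑< (bellSlice j len b n k) (suc b)
                                            ≈⟨ ∑<-*ˡ _ _ (suc b) ⟩
      ∑< (λ x → ι (k !) * bellSlice j len b n k x) (suc b)
                                            ≈⟨ ∑<-cong (suc b) (λ x → k!*bellSlice len j b n k x n≤b (k!*bellSum≈window^⊛ len (suc j) b)) ⟩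
      ∑< t (suc b)                          ≈⟨ same-range (ℕ.≤-total k n) ⟩
      ∑< t (suc k)                          ≈⟨ [single+h]^⊛-binomial j h k n ⟨
      ((λ m → single j m + h m) ^⊛ k) n     ≈⟨ ^⊛-cong n (λ m _ → window-suc j len m) k ℕ.≤-refl ⟨
      (window j (suc len) ^⊛ k) n ∎
      where
      h = window (suc j) len
      t : ℕ → Carrier
      t x = ι (k C x) * singlePow⊛ j x (h ^⊛ (k ∸ x)) n
      t-above-k : ∀ x → suc k ≤ x → t x ≈ 0#
      t-above-k x k<x = trans (*-congʳ (ι-≡ (k>n⇒nCk≡0 k<x))) (zeroˡ _)
      t-above-n : ∀ x → suc n ≤ x → t x ≈ 0#
      t-above-n x n<x = trans (*-congˡ (guard-no (j ℕ.* x ≤? n) _ (ℕ.<⇒≱ (ℕ.<-≤-trans n<x (ℕ.m≤n*m x j))))) (zeroʳ _)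
      same-range : (k ≤ n) ⊎ (n ≤ k) → ∑< t (suc b) ≈ ∑< t (suc k)
      same-range (inj₁ k≤n) = ∑<-truncate t (suc k) (suc b) (s≤s (ℕ.≤-trans k≤n n≤b)) t-above-k
      same-range (inj₂ n≤k) = trans (∑<-truncate t (suc n) (suc b) (s≤s n≤b) t-above-n)
                                    (sym (∑<-truncate t (suc n) (suc k) (s≤s n≤k) t-above-n))

    bell≈bellSum : ∀ n k → bell R n k z ≈ bellSum 1 n n n k
    bell≈bellSum n k = trans (sumList-filterᵇ _ _ (tuples n n)) (sumList-cong (tuples n n) same-term)
      where
      same-term : ∀ is → (if (sumL is ℕ.≡ᵇ k) ∧ (wsumFrom 1 is ℕ.≡ᵇ n) then ι ((n !) div denomFrom 1 is) * monoFrom R z 1 is else 0#)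
                         ≈ bellTerm 1 n k is
      same-term is with (sumL is ℕ.≡ᵇ k) ∧ (wsumFrom 1 is ℕ.≡ᵇ n) in eq
      ... | false = refl
      ... | true = *-congʳ (ι-≡ (P.trans (P.cong (λ t → (t !) div denomFrom 1 is) (P.sym w≡n)) (wsumFrom!div-denomFrom≡bellCoeff 1 is)))
        where
        w≡n : wsumFrom 1 is ≡ n
        w≡n = ≡ᵇ≡true⇒≡ (∧-conicalʳ (sumL is ℕ.≡ᵇ k) _ eq)

    z₊ : Seq
    z₊ zero = 0#
    z₊ (suc m) = z (suc m)

    k!*bell≈z₊^⊛k : ∀ n k → ι (k !) * bell R n k z ≈ (z₊ ^⊛ k) n
    k!*bell≈z₊^⊛k n k = begin
      ι (k !) * bell R n k z       ≈⟨ *-congˡ (bell≈bellSum n k) ⟩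
      ι (k !) * bellSum 1 n n n k  ≈⟨ k!*bellSum≈window^⊛ n 1 n n k ℕ.≤-refl ⟩
      (window 1 n ^⊛ k) n          ≈⟨ ^⊛-cong n window≈z₊ k ℕ.≤-refl ⟩
      (z₊ ^⊛ k) n ∎
      where
      window≈z₊ : ∀ m → m ≤ n → window 1 n m ≈ z₊ m
      window≈z₊ zero _ = refl
      window≈z₊ (suc m) 1+m≤n = guard-yes (1 ≤? suc m ×-dec suc m <? 1 ℕ.+ n) _ (s≤s z≤n , s≤s 1+m≤n)

    z₊^⊛-vanish : ∀ k n → n < k → (z₊ ^⊛ k) n ≈ 0#
    z₊^⊛-vanish (suc k) n (s≤s n≤k) = ∑<-zero (suc n) term≈0
      where
      term≈0 : ∀ m → m < suc n → ι (n C m) * (z₊ ^⊛ k) m * z₊ (n ∸ m) ≈ 0#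
      term≈0 m m<1+n with m ≟ n
      ... | yes P.refl = trans (*-congˡ (reflexive (P.cong z₊ (ℕ.n∸n≡0 m)))) (zeroʳ _)
      ... | no m≢n = trans (*-congʳ (trans (*-congˡ (z₊^⊛-vanish k m m<k)) (zeroʳ _))) (zeroˡ _)
        where
        m<k : m < k
        m<k = ℕ.<-≤-trans (ℕ.≤∧≢⇒< (ℕ.≤-pred m<1+n) m≢n) n≤k

    -- E L is (δ + z₊) ^⊛ L expanded binomially; the sum may stop at n since (z₊ ^⊛ k) n vanishes for k > n.
    E : ℕ → Seq
    E L n = ∑< (λ k → ι (L C k) * (z₊ ^⊛ k) n) (suc n)

    E-zero : ∀ n → E 0 n ≈ δ n
    E-zero n = begin
      E 0 n                                                ≈⟨ ∑<-suc (λ k → ι (0 C k) * (z₊ ^⊛ k) n) n ⟩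
      ι 1 * δ n + ∑< (λ k → ι (0 C suc k) * (z₊ ^⊛ suc k) n) n ≈⟨ +-congˡ (∑<-zero n (λ k _ → zeroˡ _)) ⟩
      ι 1 * δ n + 0#                                       ≈⟨ +-identityʳ _ ⟩
      ι 1 * δ n                                            ≈⟨ *-congʳ ι-1 ⟩
      1# * δ n                                             ≈⟨ *-identityˡ _ ⟩
      δ n ∎

    E-suc : ∀ L n → E (suc L) n ≈ E L n + (E L ⊛ z₊) n
    E-suc L n = begin
      E (suc L) n
        ≈⟨ ∑<-pascal F L n ⟩
      E L n + ∑< (λ k → ι (L C k) * F (suc k)) n
        ≈⟨ +-congˡ E⊛z₊≈ ⟨
      E L n + (E L ⊛ z₊) n ∎
      where
      F : ℕ → Carrier
      F k = (z₊ ^⊛ k) n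
      G : ℕ → Seq
      G k m = ι (L C k) * (z₊ ^⊛ k) m
      E⊛z₊≈ : (E L ⊛ z₊) n ≈ ∑< (λ k → ι (L C k) * F (suc k)) n
      E⊛z₊≈ = begin
        (E L ⊛ z₊) n
          ≈⟨ ⊛-congˡ z₊ n (λ m m≤n → sym (∑<-truncate (λ k → G k m) (suc m) (suc n) (s≤s m≤n)
                                            (λ k m<k → trans (*-congˡ (z₊^⊛-vanish k m m<k)) (zeroʳ _)))) ⟩
        ((λ m → ∑< (λ k → G k m) (suc n)) ⊛ z₊) n
          ≈⟨ ⊛-∑<ˡ G (suc n) z₊ n ⟩
        ∑< (λ k → (G k ⊛ z₊) n) (suc n)
          ≈⟨ ∑<-cong (suc n) (λ k → ⊛-*ˡ (ι (L C k)) (z₊ ^⊛ k) z₊ n) ⟩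
        ∑< (λ k → ι (L C k) * F (suc k)) (suc n)
          ≈⟨ +-congˡ (trans (*-congˡ (z₊^⊛-vanish (suc n) n ℕ.≤-refl)) (zeroʳ _)) ⟩
        ∑< (λ k → ι (L C k) * F (suc k)) n + 0#
          ≈⟨ +-identityʳ _ ⟩
        ∑< (λ k → ι (L C k) * F (suc k)) n ∎

    [1+L]*Q0≈E[1+L] : ∀ n L → ι (suc L) * Q0 R (suc n) L z ≈ E (suc L) (suc n)
    [1+L]*Q0≈E[1+L] n L = begin
      ι (suc L) * Q0 R (suc n) L z
        ≈⟨ *-congˡ (sumTo≈∑< _ (suc n)) ⟩
      ι (suc L) * ∑< (λ k → ι ((L C k) ℕ.* k !) * bell R (suc n) (suc k) z) (suc n)
        ≈⟨ ∑<-*ˡ _ _ (suc n) ⟩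
      ∑< (λ k → ι (suc L) * (ι ((L C k) ℕ.* k !) * bell R (suc n) (suc k) z)) (suc n)
        ≈⟨ ∑<-cong (suc n) term ⟩
      ∑< (λ k → ι (suc L C suc k) * (z₊ ^⊛ suc k) (suc n)) (suc n)
        ≈⟨ +-identityˡ _ ⟨
      0# + ∑< (λ k → ι (suc L C suc k) * (z₊ ^⊛ suc k) (suc n)) (suc n)
        ≈⟨ +-congʳ (zeroʳ _) ⟨
      ι 1 * (z₊ ^⊛ 0) (suc n) + ∑< (λ k → ι (suc L C suc k) * (z₊ ^⊛ suc k) (suc n)) (suc n)
        ≈⟨ ∑<-suc (λ k → ι (suc L C k) * (z₊ ^⊛ k) (suc n)) (suc n) ⟨
      E (suc L) (suc n) ∎
      where
      term : ∀ k → ι (suc L) * (ι ((L C k) ℕ.* k !) * bell R (suc n) (suc k) z) ≈ ι (suc L C suc k) * (z₊ ^⊛ suc k) (suc n)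
      term k = begin
        ι (suc L) * (ι ((L C k) ℕ.* k !) * bell R (suc n) (suc k) z)   ≈⟨ *-assoc _ _ _ ⟨
        ι (suc L) * ι ((L C k) ℕ.* k !) * bell R (suc n) (suc k) z     ≈⟨ *-congʳ (ι-* (suc L) ((L C k) ℕ.* k !)) ⟨
        ι (suc L ℕ.* ((L C k) ℕ.* k !)) * bell R (suc n) (suc k) z     ≈⟨ *-congʳ (ι-≡ ([1+L]*[LCk*k!]≡[1+L]C[1+k]*[1+k]! L k)) ⟩
        ι ((suc L C suc k) ℕ.* suc k !) * bell R (suc n) (suc k) z     ≈⟨ *-congʳ (ι-* (suc L C suc k) (suc k !)) ⟩
        ι (suc L C suc k) * ι (suc k !) * bell R (suc n) (suc k) z     ≈⟨ *-assoc _ _ _ ⟩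
        ι (suc L C suc k) * (ι (suc k !) * bell R (suc n) (suc k) z)   ≈⟨ *-congˡ (k!*bell≈z₊^⊛k (suc n) (suc k)) ⟩
        ι (suc L C suc k) * (z₊ ^⊛ suc k) (suc n) ∎

    recurrenceSum : ℕ → ℕ → Carrier
    recurrenceSum n i = sumTo R (λ m → ι (n C m) * z (n ∸ m) * Q0 R m (i ∸ 1) z) (n ∸ 1)

    E⊛z₊ : ∀ n i → (E (suc i) ⊛ z₊) (suc n) ≈ z (suc n) + ι (suc i) * recurrenceSum (suc n) (suc i)
    E⊛z₊ n i = begin
      ∑< f (suc (suc n))                            ≈⟨ ∑<-suc f (suc n) ⟩
      f 0 + (∑< (λ m → f (suc m)) n + f (suc n))    ≈⟨ +-cong f0≈z (trans (+-congˡ f[1+n]≈0) (+-identityʳ _)) ⟩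
      z (suc n) + ∑< (λ m → f (suc m)) n            ≈⟨ +-congˡ middle ⟨
      z (suc n) + ι (suc i) * recurrenceSum (suc n) (suc i) ∎
      where
      f : ℕ → Carrier
      f m = ι (suc n C m) * E (suc i) m * z₊ (suc n ∸ m)
      f0≈z : f 0 ≈ z (suc n)
      f0≈z = begin
        ι 1 * (0# + ι 1 * 1#) * z (suc n) ≈⟨ *-congʳ (*-cong ι-1 (trans (+-identityˡ _) (trans (*-identityʳ _) ι-1))) ⟩
        1# * 1# * z (suc n)               ≈⟨ trans (*-congʳ (*-identityˡ _)) (*-identityˡ _) ⟩
        z (suc n) ∎
      f[1+n]≈0 : f (suc n) ≈ 0#
      f[1+n]≈0 = trans (*-congˡ (reflexive (P.cong z₊ (ℕ.n∸n≡0 n)))) (zeroʳ _)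
      middle : ι (suc i) * recurrenceSum (suc n) (suc i) ≈ ∑< (λ m → f (suc m)) n
      middle = begin
        ι (suc i) * recurrenceSum (suc n) (suc i)
          ≈⟨ *-congˡ (sumTo≈∑< _ n) ⟩
        ι (suc i) * ∑< (λ m → ι (suc n C suc m) * z (n ∸ m) * Q0 R (suc m) i z) n
          ≈⟨ ∑<-*ˡ _ _ n ⟩
        ∑< (λ m → ι (suc i) * (ι (suc n C suc m) * z (n ∸ m) * Q0 R (suc m) i z)) n
          ≈⟨ ∑<-cong< n term ⟩
        ∑< (λ m → f (suc m)) n ∎
        where
        term : ∀ m → m < n → ι (suc i) * (ι (suc n C suc m) * z (n ∸ m) * Q0 R (suc m) i z) ≈ f (suc m)
        term m m<n = begin
          ι (suc i) * (ι (suc n C suc m) * z (n ∸ m) * Q0 R (suc m) i z)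
            ≈⟨ solve 4 (λ a b c q → a :* (b :* c :* q) := b :* (a :* q) :* c) refl _ _ _ _ ⟩
          ι (suc n C suc m) * (ι (suc i) * Q0 R (suc m) i z) * z (n ∸ m)
            ≈⟨ *-cong (*-congˡ ([1+L]*Q0≈E[1+L] m i)) (z≈z₊ (n ∸ m) (ℕ.m<n⇒0<n∸m m<n)) ⟩
          f (suc m) ∎
          where
          z≈z₊ : ∀ t → 0 < t → z t ≈ z₊ t
          z≈z₊ (suc t) _ = refl

    E[1+L]-telescope : ∀ L n → E (suc L) (suc n) ≈ ι (suc L) * z (suc n) + sumTo R (λ i → ι i * recurrenceSum (suc n) i) L
    E[1+L]-telescope zero n = begin
      E 1 (suc n)                                ≈⟨ E-suc 0 (suc n) ⟩
      E 0 (suc n) + (E 0 ⊛ z₊) (suc n)           ≈⟨ +-cong (E-zero (suc n)) (trans (⊛-congˡ z₊ (suc n) (λ m _ → E-zero m)) (δ-⊛ z₊ (suc n))) ⟩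
      0# + z (suc n)                             ≈⟨ solve 1 (λ x → con 0 :+ x := (con 1 :+ con 0) :* x :+ con 0) refl (z (suc n)) ⟩
      ι 1 * z (suc n) + 0# ∎
    E[1+L]-telescope (suc L) n = begin
      E (suc (suc L)) (suc n)
        ≈⟨ E-suc (suc L) (suc n) ⟩
      E (suc L) (suc n) + (E (suc L) ⊛ z₊) (suc n)
        ≈⟨ +-cong (E[1+L]-telescope L n) (E⊛z₊ n L) ⟩
      (ι (suc L) * z (suc n) + ∑ι) + (z (suc n) + ι (suc L) * recurrenceSum (suc n) (suc L))
        ≈⟨ solve 4 (λ a x s b → (a :* x :+ s) :+ (x :+ b) := (con 1 :+ a) :* x :+ (s :+ b)) refl _ _ _ _ ⟩
      ι (suc (suc L)) * z (suc n) + (∑ι + ι (suc L) * recurrenceSum (suc n) (suc L)) ∎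
      where
      ∑ι = sumTo R (λ i → ι i * recurrenceSum (suc n) i) L

lemma4p1 : {c ℓ : Level} (R : CommutativeRing c ℓ) →
    let open CommutativeRing R in
    (n lam : ℕ) (z : ℕ → Carrier) → 1 ≤ n →
    (w : Carrier) → w * ofℕ R (suc lam) ≈ 1# →
    Q0 R n lam z ≈
      z n + sumTo R (λ i → (ofℕ R i * w) *
                       sumTo R (λ m → ofℕ R (n C m) * z (n ∸ m) * Q0 R m (i ∸ 1) z) (n ∸ 1))
                    lam
lemma4p1 R (suc n) lam z (s≤s z≤n) w w*[1+lam]≈1 = begin
  Q0 R (suc n) lam z                                          ≈⟨ *-identityˡ _ ⟨
  1# * Q0 R (suc n) lam z                                     ≈⟨ *-congʳ w*[1+lam]≈1 ⟨
  w * ι (suc lam) * Q0 R (suc n) lam z                        ≈⟨ *-assoc _ _ _ ⟩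
  w * (ι (suc lam) * Q0 R (suc n) lam z)                      ≈⟨ *-congˡ ([1+L]*Q0≈E[1+L] n lam) ⟩
  w * E (suc lam) (suc n)                                     ≈⟨ *-congˡ (E[1+L]-telescope lam n) ⟩
  w * (ι (suc lam) * z (suc n) + ∑ι)                          ≈⟨ distribˡ _ _ _ ⟩
  w * (ι (suc lam) * z (suc n)) + w * ∑ι                      ≈⟨ +-cong w*[[1+lam]*z]≈z (sumTo-*ˡ w _ lam) ⟩
  z (suc n) + sumTo R (λ i → w * (ι i * recurrenceSum (suc n) i)) lam
    ≈⟨ +-congˡ (sumTo-cong lam (λ i → trans (sym (*-assoc _ _ _)) (*-congʳ (*-comm w (ι i))))) ⟩
  z (suc n) + sumTo R (λ i → (ι i * w) * recurrenceSum (suc n) i) lam ∎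
  where
  open CommutativeRing R
  open import Relation.Binary.Reasoning.Setoid setoid
  open Sequences R
  open Bell z
  ∑ι = sumTo R (λ i → ι i * recurrenceSum (suc n) i) lam
  w*[[1+lam]*z]≈z : w * (ι (suc lam) * z (suc n)) ≈ z (suc n)
  w*[[1+lam]*z]≈z = trans (sym (*-assoc _ _ _)) (trans (*-congʳ w*[1+lam]≈1) (*-identityˡ _))
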